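{- Let $K_n$ ($n\ge2$) be the complete graph on vertices $\epsilon_1,\dots,\epsilon_n$ with the connection given by $\nabla_{(\epsilon_i,\epsilon_j)}(\epsilon_i,\epsilon_j)=(\epsilon_j,\epsilon_i)$ and $\nabla_{(\epsilon_i,\epsilon_j)}(\epsilon_i,\epsilon_k)=(\epsilon_j,\epsilon_k)$ for $k\neq i,j$. Then the holonomy group of $K_n$ at any vertex is isomorphic to the symmetric group $S_{n-1}$ (it is the full permutation group of the $(n-1)$-element set $\mathrm{star}(x)$).
   Context: $\mathrm{star}(x)$ is the set of oriented edges starting at $x$. For a closed walk $P=(e_1,\dots,e_m)$ of oriented edges starting and ending at $x$, the parallel transport $\nabla_P=\nabla_{e_m}\circ\cdots\circ\nabla_{e_1}$ is a permutation of $\mathrm{star}(x)$. The holonomy group at $x$ is the subgroup of permutations of $\mathrm{star}(x)$ generated by all $\nabla_P$ for closed walks $P$ through $x$. -}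

module Defs where

open import Data.Nat using (ℕ)
open import Data.Fin using (Fin; _≟_)
open import Data.Product using (Σ; _,_; proj₁)
open import Relation.Binary.PropositionalEquality using (_≡_; _≢_; refl; sym)
open import Relation.Nullary using (yes; no)
open import Function using (_∘_; id)

-- Complete graph K_n on vertices Fin n.  An oriented edge is a pair (i , j) with i ≢ j.
-- star(x): oriented edges starting at x; the edge (x , k) is represented by its target k.
Star : {n : ℕ} → Fin n → Set
Star {n} x = Σ (Fin n) (λ k → k ≢ x)

_≈ₛ_ : {n : ℕ} {x : Fin n} → Star x → Star x → Set
a ≈ₛ b = proj₁ a ≡ proj₁ b

∇ : {n : ℕ} (i j : Fin n) → i ≢ j → Star i → Star j
∇ i j i≢j (k , k≢i) with k ≟ j
... | yes _   = i , i≢j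
... | no k≢j  = k , k≢j

data Walk {n : ℕ} : Fin n → Fin n → Set where
  nil  : {x : Fin n} → Walk x x
  cons : {i y : Fin n} (j : Fin n) → i ≢ j → Walk j y → Walk i y

transport : {n : ℕ} {x y : Fin n} → Walk x y → Star x → Star y
transport nil = id
transport {x = i} (cons j i≢j w) = transport w ∘ ∇ i j i≢j

_≗ₛ_ : {n : ℕ} {x : Fin n} → (Star x → Star x) → (Star x → Star x) → Set
f ≗ₛ g = ∀ s → f s ≈ₛ g s

record Perm {n : ℕ} (x : Fin n) : Set where
  field
    to       : Star x → Star x
    from     : Star x → Star x
    to-cong  : ∀ {a b} → a ≈ₛ b → to a ≈ₛ to b
    from-cong : ∀ {a b} → a ≈ₛ b → from a ≈ₛ from b
    from∘to  : (from ∘ to) ≗ₛ id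
    to∘from  : (to ∘ from) ≗ₛ id
open Perm public

data InHolonomy {n : ℕ} (x : Fin n) : Perm x → Set where
  gen   : (P : Walk x x) (σ : Perm x) → to σ ≗ₛ transport P → InHolonomy x σ
  ident : (σ : Perm x) → to σ ≗ₛ id → InHolonomy x σ
  comp  : (σ τ ρ : Perm x) → InHolonomy x σ → InHolonomy x τ →
          to ρ ≗ₛ (to τ ∘ to σ) → InHolonomy x ρ
  inv   : (σ τ : Perm x) → InHolonomy x σ → to τ ≗ₛ from σ → InHolonomy x τ

-- Transport around the triangle x → a → b → x exchanges the edges (x,a) and (x,b) of star(x)
-- and fixes every other edge, so the holonomy group contains all transpositions of star(x).
-- Transpositions generate the full permutation group: a permutation fixing every edge whose
-- target has index ≥ m + 1 becomes, after composing with the transposition of the edge a of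
-- index m and its image, a permutation fixing every edge of index ≥ m.
module Submission where

open import Defs
open import Data.Nat using (ℕ; _≤_; zero; suc; z≤n)
open import Data.Nat.Properties using (<-irrefl; ≤-reflexive; ≤∧≢⇒<; ≤-<-trans; _<?_)
open import Data.Fin using (Fin; _≟_; toℕ; fromℕ<)
open import Data.Fin.Properties using (toℕ-injective; toℕ-fromℕ<; toℕ<n)
open import Data.Product using (Σ; _,_; proj₁)
open import Data.Empty using (⊥-elim)
open import Relation.Binary.PropositionalEquality using (_≡_; _≢_; refl; sym; trans; cong)
open import Relation.Nullary using (yes; no; Dec; ¬_)
open import Function using (_∘_; id)

module _ {n : ℕ} {x : Fin n} where

  swap : Star x → Star x → Star x → Star x
  swap a b s with proj₁ s ≟ proj₁ a
  ... | yes _ = b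
  ... | no _ with proj₁ s ≟ proj₁ b
  ...   | yes _ = a
  ...   | no _  = s

  swap-left : (a b s : Star x) → s ≈ₛ a → swap a b s ≈ₛ b
  swap-left a b s s≈a with proj₁ s ≟ proj₁ a
  ... | yes _   = refl
  ... | no s≉a  = ⊥-elim (s≉a s≈a)

  swap-right : (a b s : Star x) → ¬ s ≈ₛ a → s ≈ₛ b → swap a b s ≈ₛ a
  swap-right a b s s≉a s≈b with proj₁ s ≟ proj₁ a
  ... | yes s≈a = ⊥-elim (s≉a s≈a)
  ... | no _ with proj₁ s ≟ proj₁ b
  ...   | yes _   = refl
  ...   | no s≉b  = ⊥-elim (s≉b s≈b)

  swap-other : (a b s : Star x) → ¬ s ≈ₛ a → ¬ s ≈ₛ b → swap a b s ≈ₛ s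
  swap-other a b s s≉a s≉b with proj₁ s ≟ proj₁ a
  ... | yes s≈a = ⊥-elim (s≉a s≈a)
  ... | no _ with proj₁ s ≟ proj₁ b
  ...   | yes s≈b = ⊥-elim (s≉b s≈b)
  ...   | no _    = refl

  swap-cong : (a b : Star x) → ∀ {s t} → s ≈ₛ t → swap a b s ≈ₛ swap a b t
  swap-cong a b {s} {t} s≈t with proj₁ s ≟ proj₁ a
  ... | yes s≈a = sym (swap-left a b t (trans (sym s≈t) s≈a))
  ... | no s≉a with proj₁ s ≟ proj₁ b
  ...   | yes s≈b = sym (swap-right a b t (s≉a ∘ trans s≈t) (trans (sym s≈t) s≈b))
  ...   | no s≉b  = trans s≈t (sym (swap-other a b t (s≉a ∘ trans s≈t) (s≉b ∘ trans s≈t)))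

  swap-involutive : (a b : Star x) → ∀ s → swap a b (swap a b s) ≈ₛ s
  swap-involutive a b s with proj₁ s ≟ proj₁ a
  ... | yes s≈a = trans (swap-involutive-right (proj₁ b ≟ proj₁ a)) (sym s≈a)
    where
    swap-involutive-right : Dec (b ≈ₛ a) → swap a b b ≈ₛ a
    swap-involutive-right (yes b≈a) = trans (swap-left a b b b≈a) b≈a
    swap-involutive-right (no b≉a)  = swap-right a b b b≉a refl
  ... | no s≉a with proj₁ s ≟ proj₁ b
  ...   | yes s≈b = trans (swap-left a b a refl) (sym s≈b)
  ...   | no s≉b  = swap-other a b s s≉a s≉b

  transposition : Star x → Star x → Perm x
  transposition a b = record
    { to        = swap a b
    ; from      = swap a b
    ; to-cong   = swap-cong a b
    ; from-cong = swap-cong a b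
    ; from∘to   = swap-involutive a b
    ; to∘from   = swap-involutive a b
    }

  swap-after : Star x → Star x → Perm x → Perm x
  swap-after a b σ = record
    { to        = swap a b ∘ to σ
    ; from      = from σ ∘ swap a b
    ; to-cong   = swap-cong a b ∘ to-cong σ
    ; from-cong = from-cong σ ∘ swap-cong a b
    ; from∘to   = λ s → trans (from-cong σ (swap-involutive a b (to σ s))) (from∘to σ s)
    ; to∘from   = λ s → trans (swap-cong a b (to∘from σ (swap a b s))) (swap-involutive a b s)
    }

  to-injective : (σ : Perm x) → ∀ {s t} → to σ s ≈ₛ to σ t → s ≈ₛ t
  to-injective σ {s} {t} σs≈σt =
    trans (sym (from∘to σ s)) (trans (from-cong σ σs≈σt) (from∘to σ t))

  FixesFrom : ℕ → Perm x → Set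
  FixesFrom m σ = ∀ s → m ≤ toℕ (proj₁ s) → to σ s ≈ₛ s

  fixesFrom-pred : ∀ m σ → FixesFrom (suc m) σ →
                   (∀ s → toℕ (proj₁ s) ≡ m → to σ s ≈ₛ s) → FixesFrom m σ
  fixesFrom-pred m σ fixes fixesₘ s m≤s with toℕ (proj₁ s) Data.Nat.≟ m
  ... | yes s≡m = fixesₘ s s≡m
  ... | no s≢m  = fixes s (≤∧≢⇒< m≤s (s≢m ∘ sym))

  edge-of-index : ∀ m → Dec (Σ (Star x) λ a → toℕ (proj₁ a) ≡ m)
  edge-of-index m with m <? n
  ... | no m≮n = no λ (a , a≡m) → m≮n (≤-<-trans (≤-reflexive (sym a≡m)) (toℕ<n (proj₁ a)))
  ... | yes m<n with fromℕ< m<n ≟ x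
  ...   | yes aₘ≡x = no λ ((k , k≢x) , k≡m) →
            k≢x (trans (toℕ-injective (trans k≡m (sym (toℕ-fromℕ< m<n)))) aₘ≡x)
  ...   | no aₘ≢x  = yes ((fromℕ< m<n , aₘ≢x) , toℕ-fromℕ< m<n)

  module Generation
    (H : Perm x → Set)
    (H-id : ∀ σ → to σ ≗ₛ id → H σ)
    (H-swap : ∀ a b σ ρ → ¬ a ≈ₛ b → H σ → to ρ ≗ₛ (swap a b ∘ to σ) → H ρ)
    where

    generated-fixesFrom : ∀ m σ → FixesFrom m σ → H σ
    generated-fixesFrom zero σ fixes = H-id σ (λ s → fixes s z≤n)
    generated-fixesFrom (suc m) σ fixes with edge-of-index m
    ... | no ∄a = generated-fixesFrom m σ
                   (fixesFrom-pred m σ fixes λ s s≡m → ⊥-elim (∄a (s , s≡m)))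
    ... | yes (a , a≡m) with proj₁ (to σ a) ≟ proj₁ a
    ...   | yes σa≈a = generated-fixesFrom m σ (fixesFrom-pred m σ fixes fixesₘ)
      where
      fixesₘ : ∀ s → toℕ (proj₁ s) ≡ m → to σ s ≈ₛ s
      fixesₘ s s≡m = trans (to-cong σ s≈a) (trans σa≈a (sym s≈a))
        where s≈a = toℕ-injective (trans s≡m (sym a≡m))
    ...   | no σa≉a =
      H-swap a (to σ a) τ σ (σa≉a ∘ sym) (generated-fixesFrom m τ fixesτ)
             (λ s → sym (swap-involutive a (to σ a) (to σ s)))
      where
      τ = swap-after a (to σ a) σ
      fixesτ : FixesFrom m τ
      fixesτ = fixesFrom-pred m τ fixesᵢ fixesₘ
        where
        fixesₘ : ∀ s → toℕ (proj₁ s) ≡ m → to τ s ≈ₛ s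
        fixesₘ s s≡m = trans (swap-cong a (to σ a) (to-cong σ s≈a))
                             (trans (swap-right a (to σ a) (to σ a) σa≉a refl) (sym s≈a))
          where s≈a = toℕ-injective (trans s≡m (sym a≡m))
        fixesᵢ : FixesFrom (suc m) τ
        fixesᵢ s m<s = trans (swap-cong a (to σ a) σs≈s)
                             (swap-other a (to σ a) s s≉a (s≉a ∘ to-injective σ {s} {a} ∘ trans σs≈s))
          where
          σs≈s = fixes s m<s
          s≉a : ¬ s ≈ₛ a
          s≉a s≈a = <-irrefl (trans (sym a≡m) (cong toℕ (sym s≈a))) m<s

    generated : ∀ σ → H σ
    generated σ = generated-fixesFrom n σ
      λ s n≤s → ⊥-elim (<-irrefl refl (≤-<-trans n≤s (toℕ<n (proj₁ s))))

module _ {n : ℕ} where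

  ∇-onto-target : {i j : Fin n} (i≢j : i ≢ j) (s : Star i) → proj₁ s ≡ j → proj₁ (∇ i j i≢j s) ≡ i
  ∇-onto-target {j = j} _ (k , _) k≡j with k ≟ j
  ... | yes _   = refl
  ... | no k≢j  = ⊥-elim (k≢j k≡j)

  ∇-off-target : {i j : Fin n} (i≢j : i ≢ j) (s : Star i) → proj₁ s ≢ j → proj₁ (∇ i j i≢j s) ≡ proj₁ s
  ∇-off-target {j = j} _ (k , _) k≢j with k ≟ j
  ... | yes k≡j = ⊥-elim (k≢j k≡j)
  ... | no _    = refl

  triangle : {x : Fin n} (a b : Star x) → proj₁ a ≢ proj₁ b → Walk x x
  triangle {x} (a , a≢x) (b , b≢x) a≢b =
    cons a (a≢x ∘ sym) (cons b a≢b (cons x b≢x nil))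

  transport-triangle : {x : Fin n} (a b : Star x) (a≢b : proj₁ a ≢ proj₁ b) →
                       swap a b ≗ₛ transport (triangle a b a≢b)
  transport-triangle {x} a@(a₀ , a≢x) b@(b₀ , b≢x) a≢b s@(k , k≢x) = by-cases (k ≟ a₀) (k ≟ b₀)
    where
    s₁ = ∇ x a₀ (a≢x ∘ sym) s
    s₂ = ∇ a₀ b₀ a≢b s₁
    by-cases : Dec (k ≡ a₀) → Dec (k ≡ b₀) → swap a b s ≈ₛ transport (triangle a b a≢b) s
    by-cases (yes k≡a) _ =
      trans (swap-left a b s k≡a) (sym (∇-onto-target b≢x s₂ (trans (∇-off-target a≢b s₁ s₁≢b) s₁≡a)))
      where
      s₁≡a = ∇-onto-target (a≢x ∘ sym) s k≡a
      s₁≢b = λ s₁≡b → b≢x (trans (sym s₁≡b) s₁≡a)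
    by-cases (no k≢a) (yes k≡b) =
      trans (swap-right a b s k≢a k≡b) (sym (trans (∇-off-target b≢x s₂ s₂≢x) s₂≡a))
      where
      s₂≡a = ∇-onto-target a≢b s₁ (trans (∇-off-target (a≢x ∘ sym) s k≢a) k≡b)
      s₂≢x = λ s₂≡x → a≢x (trans (sym s₂≡a) s₂≡x)
    by-cases (no k≢a) (no k≢b) =
      trans (swap-other a b s k≢a k≢b) (sym (trans (∇-off-target b≢x s₂ s₂≢x) s₂≡k))
      where
      s₁≡k = ∇-off-target (a≢x ∘ sym) s k≢a
      s₂≡k = trans (∇-off-target a≢b s₁ (λ s₁≡b → k≢b (trans (sym s₁≡k) s₁≡b))) s₁≡k
      s₂≢x = λ s₂≡x → k≢x (trans (sym s₂≡k) s₂≡x)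

  transposition-in-holonomy : {x : Fin n} (a b : Star x) → ¬ a ≈ₛ b → InHolonomy x (transposition a b)
  transposition-in-holonomy a b a≢b =
    gen (triangle a b a≢b) (transposition a b) (transport-triangle a b a≢b)

mainTheorem13 : (n : ℕ) → 2 ≤ n → (x : Fin n) → (σ : Perm x) → InHolonomy x σ
mainTheorem13 n _ x = generated
  where
  open Generation (InHolonomy x) ident
    (λ a b σ ρ a≢b σ∈H ρ≗swap∘σ →
       comp σ (transposition a b) ρ σ∈H (transposition-in-holonomy a b a≢b) ρ≗swap∘σ)
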